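{- Let $N \ge 1$, let $G_N$ be the divisibility graph on $X_N=\{1,\dots,N\}$, and let $n \in X_N$ have degree $k_n$. Let $e_n$ be the number of unordered pairs of distinct neighbours of $n$ that are adjacent. Then $$\sum_{\{s,t\}} n^n_{st} = \binom{k_n}{2} - e_n,$$ where the sum runs over unordered pairs $\{s,t\}$ of distinct vertices of $X_N\setminus\{n\}$; this quantity equals the number of unordered pairs of neighbours of $n$ between which there is no edge.
   Context: The divisibility graph $G_N$ is the simple undirected graph with vertex set $X_N=\{1,\dots,N\}$, in which two distinct vertices $i \ne j$ are adjacent if and only if $i$ divides $j$ or $j$ divides $i$ (no loops). The degree $k_n$ is the number of neighbours (adjacent vertices) of $n$. For distinct vertices $s,t$ and a vertex $n \notin \{s,t\}$, $n^n_{st}$ is the number of shortest paths between $s$ and $t$ that pass through $n$. -}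

module Defs where

open import Data.Nat using (ℕ; zero; suc; _<_; _<?_; _≟_)
open import Data.Nat.Divisibility using (_∣_; _∣?_)
open import Data.List using (List; []; _∷_; map; upTo; concatMap; filter; length; cartesianProduct)
open import Data.Nat.ListAction using (sum)
open import Data.List.Membership.DecPropositional _≟_ using (_∈_; _∈?_)
open import Data.List.Relation.Unary.All using (All; all?)
open import Data.Product using (_×_; _,_; uncurry)
open import Data.Sum using (_⊎_)
open import Data.Empty using (⊥)
open import Relation.Nullary using (¬_; Dec; yes; no)
open import Relation.Nullary.Decidable using (_×-dec_; _⊎-dec_; ¬?)
open import Relation.Binary.PropositionalEquality using (_≡_; _≢_)

X : ℕ → List ℕ
X N = map suc (upTo N)

Adj : ℕ → ℕ → Set
Adj i j = (i ≢ j) × (i ∣ j ⊎ j ∣ i)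

Adj? : (i j : ℕ) → Dec (Adj i j)
Adj? i j = ¬? (i ≟ j) ×-dec ((i ∣? j) ⊎-dec (j ∣? i))

seqs : ℕ → ℕ → List (List ℕ)
seqs N zero    = [] ∷ []
seqs N (suc L) = concatMap (λ v → map (v ∷_) (seqs N L)) (X N)

-- WalkFrom s t p : s followed by the vertices of p is a walk (consecutive
-- vertices adjacent) ending at t.  Its length is length p.
WalkFrom : ℕ → ℕ → List ℕ → Set
WalkFrom s t []      = s ≡ t
WalkFrom s t (v ∷ p) = Adj s v × WalkFrom v t p

walkFrom? : (s t : ℕ) (p : List ℕ) → Dec (WalkFrom s t p)
walkFrom? s t []      = s ≟ t
walkFrom? s t (v ∷ p) = Adj? s v ×-dec walkFrom? v t p

walks : ℕ → ℕ → ℕ → ℕ → List (List ℕ)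
walks N L s t = filter (walkFrom? s t) (seqs N L)

isEmpty? : {A : Set} (xs : List A) → Dec (xs ≡ [])
isEmpty? []      = yes Relation.Binary.PropositionalEquality.refl
isEmpty? (x ∷ xs) = no (λ ())

Shortest : ℕ → ℕ → ℕ → List ℕ → Set
Shortest N s t p = All (λ L → walks N L s t ≡ []) (upTo (length p))

shortest? : (N s t : ℕ) (p : List ℕ) → Dec (Shortest N s t p)
shortest? N s t p = all? (λ L → isEmpty? (walks N L s t)) (upTo (length p))

-- Candidate walks from s to t of length < N (a shortest path in a graph on
-- N vertices has length at most N - 1).
candidates : ℕ → ℕ → ℕ → List (List ℕ)
candidates N s t = concatMap (λ L → walks N L s t) (upTo N)

-- n^n_{st}: number of shortest paths between s and t passing through n
-- (for n ∉ {s,t}, "passing through" = n occurs among the path's vertices).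
nPaths : ℕ → ℕ → ℕ → ℕ → ℕ
nPaths N n s t =
  length (filter (λ p → (n ∈? p) ×-dec shortest? N s t p) (candidates N s t))

pairsAvoiding : ℕ → ℕ → List (ℕ × ℕ)
pairsAvoiding N n =
  filter (λ st → (Data.Product.proj₁ st <? Data.Product.proj₂ st)
                  ×-dec (¬? (Data.Product.proj₁ st ≟ n) ×-dec ¬? (Data.Product.proj₂ st ≟ n)))
         (cartesianProduct (X N) (X N))

betweennessSum : ℕ → ℕ → ℕ
betweennessSum N n = sum (map (uncurry (nPaths N n)) (pairsAvoiding N n))

neighbours : ℕ → ℕ → List ℕ
neighbours N n = filter (Adj? n) (X N)

degree : ℕ → ℕ → ℕ
degree N n = length (neighbours N n)

neighbourPairs : ℕ → ℕ → List (ℕ × ℕ)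
neighbourPairs N n =
  filter (λ uv → Data.Product.proj₁ uv <? Data.Product.proj₂ uv)
         (cartesianProduct (neighbours N n) (neighbours N n))

edgesAmongNeighbours : ℕ → ℕ → ℕ
edgesAmongNeighbours N n = length (filter (uncurry Adj?) (neighbourPairs N n))

nonEdgesAmongNeighbours : ℕ → ℕ → ℕ
nonEdgesAmongNeighbours N n =
  length (filter (λ uv → ¬? (uncurry Adj? uv)) (neighbourPairs N n))

module Submission where

-- Vertex 1 divides every vertex, so G_N has diameter at most 2.  Hence for
-- distinct s, t ≠ n, a shortest s–t path through n exists only if s and t are
-- non-adjacent neighbours of n, and then it is the single path s, n, t.  The sum
-- therefore counts the non-adjacent pairs of neighbours of n, of which there are
-- C(k_n, 2) − e_n.

open import Defs
open import Data.Nat using (ℕ; zero; suc; _+_; _∸_; _≤_; _<_; _<?_; _≟_; z≤n; s≤s)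
open import Data.Nat.Properties
  using (<-irrefl; <-asym; <⇒≢; <⇒≱; ≮⇒≥; ≤∧≢⇒<; ≤-refl; ≤-trans; ≤-<-trans; <-≤-trans; +-suc; m+n∸m≡n)
open import Data.Nat.Combinatorics using (_C_; nC1≡n; nCk+nC[k+1]≡[n+1]C[k+1])
open import Data.Nat.Divisibility using (1∣_)
open import Data.Nat.ListAction using (sum)
open import Data.List using (List; []; _∷_; _++_; map; filter; length; upTo; cartesianProduct)
open import Data.List.Properties
  using (filter-accept; filter-reject; filter-none; filter-all; filter-++; filter-≐;
         length-++; length-map; map-cong-local; ∷-injectiveˡ; ∷-injectiveʳ)
open import Data.List.Membership.Propositional using (_∈_)
open import Data.List.Membership.Propositional.Properties
  using (∈-map⁺; ∈-map⁻; ∈-filter⁺; ∈-filter⁻; ∈-concatMap⁺; ∈-concatMap⁻; ∈-cartesianProduct⁻; ∈-upTo⁺; ∈-upTo⁻; ∉[])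
open import Data.List.Relation.Unary.Any as Any using (here; there)
open import Data.List.Relation.Unary.All as All using (All; []; _∷_)
import Data.List.Relation.Unary.All.Properties as All
open import Data.List.Relation.Unary.AllPairs as AllPairs using (AllPairs; []; _∷_)
import Data.List.Relation.Unary.AllPairs.Properties as AllPairs
open import Data.List.Relation.Unary.Unique.Propositional using (Unique)
import Data.List.Relation.Unary.Unique.Propositional.Properties as Unique
open import Data.List.Relation.Binary.Disjoint.Propositional using (Disjoint)
open import Data.Product using (_×_; _,_; proj₁; proj₂; ∃; uncurry)
open import Data.Sum using (inj₁; swap)
open import Function using (_∘_; id)
open import Relation.Nullary using (¬_; Dec; yes; no; contradiction)
open import Relation.Nullary.Decidable using (_×-dec_; ¬?)
open import Relation.Unary using (Pred; Decidable; _∩_; ∁)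
open import Relation.Unary.Properties using (_∩?_; ∁?)
open import Relation.Binary.PropositionalEquality
  using (_≡_; _≢_; refl; sym; trans; cong; cong₂; subst; module ≡-Reasoning)

open ≡-Reasoning

indicator : ∀ {p} {P : Set p} → Dec P → ℕ
indicator (yes _) = 1
indicator (no _)  = 0

count : ∀ {a p} {A : Set a} {P : Pred A p} → Decidable P → List A → ℕ
count P? xs = length (filter P? xs)

module _ {a p} {A : Set a} {P : Pred A p} (P? : Decidable P) where

  sum-indicator : ∀ xs → sum (map (indicator ∘ P?) xs) ≡ count P? xs
  sum-indicator []       = refl
  sum-indicator (x ∷ xs) with P? x
  ... | yes _ = cong suc (sum-indicator xs)
  ... | no _  = sum-indicator xs

  count+count-∁≡length : ∀ xs → count P? xs + count (∁? P?) xs ≡ length xs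
  count+count-∁≡length []       = refl
  count+count-∁≡length (x ∷ xs) with P? x
  ... | yes _ = cong suc (count+count-∁≡length xs)
  ... | no _  = trans (+-suc _ _) (cong suc (count+count-∁≡length xs))

  filter-filter : ∀ {q} {Q : Pred A q} (Q? : Decidable Q) xs →
                  filter P? (filter Q? xs) ≡ filter (Q? ∩? P?) xs
  filter-filter Q? [] = refl
  filter-filter Q? (x ∷ xs) with Q? x
  ... | no _ = filter-filter Q? xs
  ... | yes _ with P? x
  ...   | yes _ = cong (x ∷_) (filter-filter Q? xs)
  ...   | no _  = filter-filter Q? xs

  count-unique≡1 : ∀ {xs a} → Unique xs → a ∈ xs → P a → (∀ {x} → x ∈ xs → P x → x ≡ a) →
                   count P? xs ≡ 1
  count-unique≡1 (a∉xs ∷ _) (here refl) Pa only = cong length (trans (filter-accept P? Pa)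
    (cong (_ ∷_) (filter-none P? (All.tabulate λ x∈ Px → All.lookup a∉xs x∈ (sym (only (there x∈) Px))))))
  count-unique≡1 (x∉xs ∷ u) (there a∈) Pa only =
    trans (cong length (filter-reject P? λ Px → All.lookup x∉xs a∈ (only (here refl) Px)))
          (count-unique≡1 u a∈ Pa (only ∘ there))

module _ {a b p} {A : Set a} {B : Set b} {P : Pred B p} (P? : Decidable P) where

  filter-map : ∀ (f : A → B) xs → filter P? (map f xs) ≡ map f (filter (P? ∘ f) xs)
  filter-map f [] = refl
  filter-map f (x ∷ xs) with P? (f x)
  ... | yes _ = cong (f x ∷_) (filter-map f xs)
  ... | no _  = filter-map f xs

  count-map : ∀ (f : A → B) xs → count P? (map f xs) ≡ count (P? ∘ f) xs
  count-map f xs = trans (cong length (filter-map f xs)) (length-map f (filter (P? ∘ f) xs))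

count-cartesianProduct : ∀ {a b p} {A : Set a} {B : Set b} {P : Pred (A × B) p} (P? : Decidable P) xs ys →
  count P? (cartesianProduct xs ys) ≡ sum (map (λ x → count (P? ∘ (x ,_)) ys) xs)
count-cartesianProduct P? []       ys = refl
count-cartesianProduct P? (x ∷ xs) ys = begin
  length (filter P? (map (x ,_) ys ++ cartesianProduct xs ys))
    ≡⟨ cong length (filter-++ P? (map (x ,_) ys) _) ⟩
  length (filter P? (map (x ,_) ys) ++ filter P? (cartesianProduct xs ys))
    ≡⟨ length-++ (filter P? (map (x ,_) ys)) ⟩
  count P? (map (x ,_) ys) + count P? (cartesianProduct xs ys)
    ≡⟨ cong₂ _+_ (count-map P? (x ,_) ys) (count-cartesianProduct P? xs ys) ⟩
  count (P? ∘ (x ,_)) ys + sum (map (λ x → count (P? ∘ (x ,_)) ys) xs) ∎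

module _ {a b p q} {A : Set a} {B : Set b} {P : Pred A p} {Q : Pred B q}
         (P? : Decidable P) (Q? : Decidable Q) where

  private
    R? : Decidable ((P ∘ proj₁) ∩ (Q ∘ proj₂))
    R? = (P? ∘ proj₁) ∩? (Q? ∘ proj₂)

  cartesianProduct-filter : ∀ xs ys →
    cartesianProduct (filter P? xs) (filter Q? ys) ≡ filter ((P? ∘ proj₁) ∩? (Q? ∘ proj₂)) (cartesianProduct xs ys)
  cartesianProduct-filter []       ys = refl
  cartesianProduct-filter (x ∷ xs) ys with P? x
  ... | yes px = begin
    map (x ,_) (filter Q? ys) ++ cartesianProduct (filter P? xs) (filter Q? ys)
      ≡⟨ cong₂ _++_ row (cartesianProduct-filter xs ys) ⟩
    filter R? (map (x ,_) ys) ++ filter R? (cartesianProduct xs ys)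
      ≡⟨ filter-++ R? (map (x ,_) ys) _ ⟨
    filter R? (map (x ,_) ys ++ cartesianProduct xs ys) ∎
    where
    row : map (x ,_) (filter Q? ys) ≡ filter R? (map (x ,_) ys)
    row = sym (trans (filter-map R? (x ,_) ys)
                     (cong (map (x ,_)) (filter-≐ (R? ∘ (x ,_)) Q? (proj₂ , (px ,_)) ys)))
  ... | no ¬px = begin
    cartesianProduct (filter P? xs) (filter Q? ys)
      ≡⟨ cartesianProduct-filter xs ys ⟩
    filter R? (cartesianProduct xs ys)
      ≡⟨ cong (_++ filter R? (cartesianProduct xs ys)) row ⟨
    filter R? (map (x ,_) ys) ++ filter R? (cartesianProduct xs ys)
      ≡⟨ filter-++ R? (map (x ,_) ys) _ ⟨
    filter R? (map (x ,_) ys ++ cartesianProduct xs ys) ∎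
    where
    row : filter R? (map (x ,_) ys) ≡ []
    row = trans (filter-map R? (x ,_) ys)
                (cong (map (x ,_)) (filter-none (R? ∘ (x ,_)) {xs = ys} (All.tabulate λ _ → ¬px ∘ proj₁)))

length-increasingPairs : ∀ {xs} → AllPairs _<_ xs →
  count (λ ab → proj₁ ab <? proj₂ ab) (cartesianProduct xs xs) ≡ length xs C 2
length-increasingPairs {xs} increasing =
  trans (count-cartesianProduct (λ ab → proj₁ ab <? proj₂ ab) xs xs) (rows increasing)
  where
  rows : ∀ {ys} → AllPairs _<_ ys → sum (map (λ a → count (a <?_) ys) ys) ≡ length ys C 2
  rows [] = refl
  rows {x ∷ ys} (x<ys ∷ increasing) = begin
    count (x <?_) (x ∷ ys) + sum (map (λ a → count (a <?_) (x ∷ ys)) ys)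
      ≡⟨ cong₂ _+_ first (cong sum (map-cong-local (All.map later x<ys))) ⟩
    length ys + sum (map (λ a → count (a <?_) ys) ys)
      ≡⟨ cong (length ys +_) (rows increasing) ⟩
    length ys + length ys C 2
      ≡⟨ cong (_+ length ys C 2) (nC1≡n (length ys)) ⟨
    length ys C 1 + length ys C 2
      ≡⟨ nCk+nC[k+1]≡[n+1]C[k+1] (length ys) 1 ⟩
    suc (length ys) C 2 ∎
    where
    first : count (x <?_) (x ∷ ys) ≡ length ys
    first = cong length (trans (filter-reject (x <?_) (<-irrefl refl)) (filter-all (x <?_) x<ys))
    later : ∀ {a} → x < a → count (a <?_) (x ∷ ys) ≡ count (a <?_) ys
    later {a} x<a = cong length (filter-reject (a <?_) (<-asym x<a))

map-∷-disjoint : ∀ {a} {A : Set a} {v w : A} {xss yss} → v ≢ w → Disjoint (map (v ∷_) xss) (map (w ∷_) yss)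
map-∷-disjoint v≢w (p∈ , p∈′)
  with _ , _ , refl ← ∈-map⁻ _ p∈
  with _ , _ , eq ← ∈-map⁻ _ p∈′
  = v≢w (∷-injectiveˡ eq)

∈-X⁺ : ∀ {N a} → 1 ≤ a → a ≤ N → a ∈ X N
∈-X⁺ {a = suc b} _ a≤N = ∈-map⁺ suc (∈-upTo⁺ a≤N)

∈-X⁻ : ∀ {N a} → a ∈ X N → 1 ≤ a × a ≤ N
∈-X⁻ a∈ with b , b∈ , refl ← ∈-map⁻ suc a∈ = s≤s z≤n , ∈-upTo⁻ b∈

X-increasing : ∀ N → AllPairs _<_ (X N)
X-increasing N = AllPairs.map⁺ (AllPairs.applyUpTo⁺₁ id N (λ i<j _ → s≤s i<j))

X-unique : ∀ N → Unique (X N)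
X-unique N = AllPairs.map <⇒≢ (X-increasing N)

Adj-sym : ∀ {i j} → Adj i j → Adj j i
Adj-sym (i≢j , d) = i≢j ∘ sym , swap d

1-Adj : ∀ {a} → 1 ≢ a → Adj 1 a
1-Adj 1≢a = 1≢a , inj₁ (1∣ _)

nonAdjacent⇒≢1 : ∀ {s t} → s ≢ t → ¬ Adj s t → 1 ≢ s × 1 ≢ t
nonAdjacent⇒≢1 s≢t ¬st = (λ { refl → ¬st (1-Adj s≢t) }) , (λ { refl → ¬st (Adj-sym (1-Adj (s≢t ∘ sym))) })

nonAdjacent⇒2≤length : ∀ {s t} q → s ≢ t → ¬ Adj s t → WalkFrom s t q → 2 ≤ length q
nonAdjacent⇒2≤length []          s≢t _   s≡t         = contradiction s≡t s≢t
nonAdjacent⇒2≤length (_ ∷ [])    _   ¬st (st , refl) = contradiction st ¬st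
nonAdjacent⇒2≤length (_ ∷ _ ∷ _) _   _   _           = s≤s (s≤s z≤n)

seqs-length : ∀ {N L p} → p ∈ seqs N L → length p ≡ L
seqs-length {L = zero} (here refl) = refl
seqs-length {N} {suc L} p∈
  with v , vq∈ ← Any.satisfied (∈-concatMap⁻ (λ v → map (v ∷_) (seqs N L)) {xs = X N} p∈)
  with q , q∈ , refl ← ∈-map⁻ (v ∷_) vq∈
  = cong suc (seqs-length q∈)

∈-seqs : ∀ {N} p → All (_∈ X N) p → p ∈ seqs N (length p)
∈-seqs []      []            = here refl
∈-seqs {N} (v ∷ p) (v∈ ∷ p∈) =
  ∈-concatMap⁺ (λ w → map (w ∷_) (seqs N (length p))) (Any.map (λ { refl → ∈-map⁺ (v ∷_) (∈-seqs p p∈) }) v∈)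

seqs-unique : ∀ N L → Unique (seqs N L)
seqs-unique N zero    = [] ∷ []
seqs-unique N (suc L) =
  Unique.concat⁺ (All.map⁺ (All.tabulate λ _ → Unique.map⁺ ∷-injectiveʳ (seqs-unique N L)))
                 (AllPairs.map⁺ (AllPairs.map map-∷-disjoint (X-unique N)))

Midpoint : ℕ → ℕ → ℕ → Set
Midpoint n s t = Adj n s × Adj n t × ¬ Adj s t

midpoint? : ∀ n s t → Dec (Midpoint n s t)
midpoint? n s t = Adj? n s ×-dec Adj? n t ×-dec ¬? (Adj? s t)

module _ {N s t : ℕ} where

  walks-walk : ∀ {L p} → p ∈ walks N L s t → WalkFrom s t p
  walks-walk {L} p∈ = proj₂ (∈-filter⁻ (walkFrom? s t) {xs = seqs N L} p∈)

  walks-length : ∀ {L p} → p ∈ walks N L s t → length p ≡ L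
  walks-length {L} p∈ = seqs-length (proj₁ (∈-filter⁻ (walkFrom? s t) {xs = seqs N L} p∈))

  ∈-walks : ∀ {p} → WalkFrom s t p → All (_∈ X N) p → p ∈ walks N (length p) s t
  ∈-walks {p} w p∈X = ∈-filter⁺ (walkFrom? s t) (∈-seqs p p∈X) w

  candidates-walk : ∀ {p} → p ∈ candidates N s t → WalkFrom s t p
  candidates-walk p∈ with L , p∈walks ← Any.satisfied (∈-concatMap⁻ (λ L → walks N L s t) {xs = upTo N} p∈)
    = walks-walk {L} p∈walks

  ∈-candidates : ∀ {p} → WalkFrom s t p → All (_∈ X N) p → length p < N → p ∈ candidates N s t
  ∈-candidates w p∈X p<N =
    ∈-concatMap⁺ (λ L → walks N L s t) (Any.map (λ { refl → ∈-walks w p∈X }) (∈-upTo⁺ p<N))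

  candidates-unique : Unique (candidates N s t)
  candidates-unique =
    Unique.concat⁺ (All.map⁺ (All.tabulate λ {L} _ → Unique.filter⁺ (walkFrom? s t) (seqs-unique N L)))
                   (AllPairs.map⁺ (AllPairs.map differentLengths (Unique.upTo⁺ N)))
    where
    differentLengths : ∀ {L L′} → L ≢ L′ → Disjoint (walks N L s t) (walks N L′ s t)
    differentLengths L≢L′ (p∈ , p∈′) = L≢L′ (trans (sym (walks-length p∈)) (walks-length p∈′))

  Shortest⇒minimal : ∀ {p q} → Shortest N s t p → WalkFrom s t q → All (_∈ X N) q → length p ≤ length q
  Shortest⇒minimal sh w q∈X = ≮⇒≥ λ q<p → ∉[] (subst (_ ∈_) (All.lookup sh (∈-upTo⁺ q<p)) (∈-walks w q∈X))

  minimal⇒Shortest : ∀ {p} → (∀ {q} → WalkFrom s t q → length p ≤ length q) → Shortest N s t p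
  minimal⇒Shortest {p} minimal = All.tabulate λ L∈ → filter-none (walkFrom? s t) (All.tabulate λ q∈ w →
    <⇒≱ (subst (_< length p) (sym (seqs-length q∈)) (∈-upTo⁻ L∈)) (minimal w))

  diameter≤2 : s ∈ X N → t ∈ X N → s ≢ t → ∃ λ q → WalkFrom s t q × All (_∈ X N) q × length q ≤ 2
  diameter≤2 s∈ t∈ s≢t with Adj? s t
  ... | yes st = t ∷ [] , (st , refl) , t∈ ∷ [] , s≤s z≤n
  ... | no ¬st = 1 ∷ t ∷ [] , (Adj-sym (1-Adj (proj₁ 1≢st)) , 1-Adj (proj₂ 1≢st) , refl) , 1∈X ∷ t∈ ∷ [] , ≤-refl
    where
    1≢st : 1 ≢ s × 1 ≢ t
    1≢st = nonAdjacent⇒≢1 s≢t ¬st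
    1∈X : 1 ∈ X N
    1∈X = ∈-X⁺ ≤-refl (≤-trans (proj₁ (∈-X⁻ s∈)) (proj₂ (∈-X⁻ s∈)))

  shortest-through : ∀ {n} p → s ∈ X N → t ∈ X N → s ≢ t → t ≢ n →
    WalkFrom s t p → Shortest N s t p → n ∈ p → p ≡ n ∷ t ∷ [] × Midpoint n s t
  shortest-through (_ ∷ []) _ _ _ t≢n (_ , refl) _ (here refl) = contradiction refl t≢n
  shortest-through p@(_ ∷ _ ∷ []) _ t∈ _ _ (sv , vt , refl) sh (here refl) =
    refl , Adj-sym sv , vt , λ st → contradiction (Shortest⇒minimal {p} sh (st , refl) (t∈ ∷ [])) λ { (s≤s ()) }
  shortest-through (_ ∷ _ ∷ []) _ _ _ t≢n (_ , _ , refl) _ (there (here refl)) = contradiction refl t≢n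
  shortest-through p@(_ ∷ _ ∷ _ ∷ _) s∈ t∈ s≢t _ _ sh _
    with q , w , q∈X , q≤2 ← diameter≤2 s∈ t∈ s≢t
    = contradiction (≤-trans (Shortest⇒minimal {p} sh w q∈X) q≤2) λ { (s≤s (s≤s ())) }

  nPaths≡indicator : ∀ {n} → n ∈ X N → s ∈ X N → t ∈ X N → s < t → t ≢ n →
    nPaths N n s t ≡ indicator (midpoint? n s t)
  nPaths≡indicator {n} n∈ s∈ t∈ s<t t≢n with midpoint? n s t
  ... | no ¬mid = cong length (filter-none _ {xs = candidates N s t} (All.tabulate λ {p} p∈ (n∈p , sh) →
    ¬mid (proj₂ (shortest-through p s∈ t∈ (<⇒≢ s<t) t≢n (candidates-walk p∈) sh n∈p))))
  ... | yes (ns , nt , ¬st) = count-unique≡1 _ candidates-unique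
    (∈-candidates path (n∈ ∷ t∈ ∷ []) 2<N)
    (here refl , minimal⇒Shortest {n ∷ t ∷ []} (λ {q} → nonAdjacent⇒2≤length q (<⇒≢ s<t) ¬st))
    (λ {p} p∈ (n∈p , sh) → proj₁ (shortest-through p s∈ t∈ (<⇒≢ s<t) t≢n (candidates-walk p∈) sh n∈p))
    where
    path : WalkFrom s t (n ∷ t ∷ [])
    path = Adj-sym ns , nt , refl
    2<N : 2 < N
    2<N = <-≤-trans (≤-<-trans (≤∧≢⇒< (proj₁ (∈-X⁻ s∈)) (proj₁ (nonAdjacent⇒≢1 (<⇒≢ s<t) ¬st))) s<t)
                    (proj₂ (∈-X⁻ t∈))

midpointPairs≡nonAdjacentNeighbourPairs : ∀ N n →
  filter (uncurry (midpoint? n)) (pairsAvoiding N n) ≡ filter (∁? (uncurry Adj?)) (neighbourPairs N n)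
midpointPairs≡nonAdjacentNeighbourPairs N n = begin
  filter M? (filter D? XX)                ≡⟨ filter-filter M? D? XX ⟩
  filter (D? ∩? M?) XX                    ≡⟨ filter-≐ _ _ (to , from) XX ⟩
  filter (B? ∩? L? ∩? NA?) XX             ≡⟨ filter-filter (L? ∩? NA?) B? XX ⟨
  filter (L? ∩? NA?) (filter B? XX)       ≡⟨ filter-filter NA? L? (filter B? XX) ⟨
  filter NA? (filter L? (filter B? XX))
    ≡⟨ cong (filter NA? ∘ filter L?) (cartesianProduct-filter (Adj? n) (Adj? n) (X N) (X N)) ⟨
  filter NA? (neighbourPairs N n) ∎
  where
  XX : List (ℕ × ℕ)
  XX = cartesianProduct (X N) (X N)
  M? : Decidable (uncurry (Midpoint n))
  M? = uncurry (midpoint? n)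
  D? : Decidable (λ (st : ℕ × ℕ) → proj₁ st < proj₂ st × proj₁ st ≢ n × proj₂ st ≢ n)
  D? st = (proj₁ st <? proj₂ st) ×-dec (¬? (proj₁ st ≟ n) ×-dec ¬? (proj₂ st ≟ n))
  B? : Decidable ((Adj n ∘ proj₁) ∩ (Adj n ∘ proj₂))
  B? = (Adj? n ∘ proj₁) ∩? (Adj? n ∘ proj₂)
  L? : Decidable (uncurry _<_)
  L? st = proj₁ st <? proj₂ st
  NA? : Decidable (∁ (uncurry Adj))
  NA? = ∁? (uncurry Adj?)
  to : ∀ {s t} → (s < t × s ≢ n × t ≢ n) × Midpoint n s t → (Adj n s × Adj n t) × s < t × ¬ Adj s t
  to ((s<t , _) , (ns , nt , ¬st)) = (ns , nt) , s<t , ¬st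
  from : ∀ {s t} → (Adj n s × Adj n t) × s < t × ¬ Adj s t → (s < t × s ≢ n × t ≢ n) × Midpoint n s t
  from ((ns , nt) , s<t , ¬st) = (s<t , proj₁ (Adj-sym ns) , proj₁ (Adj-sym nt)) , ns , nt , ¬st

betweennessSum≡nonEdges : ∀ {N n} → 1 ≤ n → n ≤ N → betweennessSum N n ≡ nonEdgesAmongNeighbours N n
betweennessSum≡nonEdges {N} {n} 1≤n n≤N = begin
  sum (map (uncurry (nPaths N n)) (pairsAvoiding N n))
    ≡⟨ cong sum (map-cong-local (All.tabulate paths≡indicator)) ⟩
  sum (map (indicator ∘ uncurry (midpoint? n)) (pairsAvoiding N n))
    ≡⟨ sum-indicator (uncurry (midpoint? n)) (pairsAvoiding N n) ⟩
  count (uncurry (midpoint? n)) (pairsAvoiding N n)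
    ≡⟨ cong length (midpointPairs≡nonAdjacentNeighbourPairs N n) ⟩
  nonEdgesAmongNeighbours N n ∎
  where
  paths≡indicator : ∀ {st} → st ∈ pairsAvoiding N n → uncurry (nPaths N n) st ≡ indicator (uncurry (midpoint? n) st)
  paths≡indicator st∈ =
    let (st∈XX , s<t , _ , t≢n) = ∈-filter⁻ _ {xs = cartesianProduct (X N) (X N)} st∈
        (s∈ , t∈) = ∈-cartesianProduct⁻ (X N) (X N) st∈XX
    in nPaths≡indicator (∈-X⁺ 1≤n n≤N) s∈ t∈ s<t t≢n

binomial∸edges≡nonEdges : ∀ N n → degree N n C 2 ∸ edgesAmongNeighbours N n ≡ nonEdgesAmongNeighbours N n
binomial∸edges≡nonEdges N n = begin
  degree N n C 2 ∸ edges
    ≡⟨ cong (_∸ edges) (trans (count+count-∁≡length (uncurry Adj?) (neighbourPairs N n)) lengthPairs) ⟨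
  edges + nonEdgesAmongNeighbours N n ∸ edges
    ≡⟨ m+n∸m≡n edges _ ⟩
  nonEdgesAmongNeighbours N n ∎
  where
  edges : ℕ
  edges = edgesAmongNeighbours N n
  lengthPairs : length (neighbourPairs N n) ≡ degree N n C 2
  lengthPairs = length-increasingPairs (AllPairs.filter⁺ (Adj? n) (X-increasing N))

corollary6 : (N : ℕ) → 1 ≤ N → (n : ℕ) → 1 ≤ n → n ≤ N →
    (betweennessSum N n ≡ degree N n C 2 ∸ edgesAmongNeighbours N n)
    × (betweennessSum N n ≡ nonEdgesAmongNeighbours N n)
corollary6 N _ n 1≤n n≤N = trans between (sym (binomial∸edges≡nonEdges N n)) , between
  where
  between : betweennessSum N n ≡ nonEdgesAmongNeighbours N n
  between = betweennessSum≡nonEdges 1≤n n≤N
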